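{- Let $G$ be a loopless directed graph. If $M$ is a finite ring of characteristic $p$, then $\chi(G)/\chi_{TT_M}(G)<p$. Moreover, $\chi(G)/\chi_{TT_{\mathbb Z}}(G)<2$.
   Context: Graphs are finite directed, with multiple edges allowed. $\chi(G)$ is the chromatic number of the underlying undirected graph. A ring is associative with unity; the characteristic of a finite ring is the least $p\ge1$ with $p\cdot 1=0$. A circuit is a connected subgraph in which every vertex is incident with exactly two edge-ends; $C^+$/$C^-$ are its edges traversed forwards/backwards. An $M$-tension on $D$ is $\tau:E(D)\to M$ with $\sum_{C^+}\tau=\sum_{C^- }\tau$ for every circuit $C$; $f:E(D)\to E(D')$ is $M$-tension-continuous ($TT_M$) if $\tau\circ f$ is an $M$-tension for every $M$-tension $\tau$ on $D'$. The $TT_M$-number $\chi_{TT_M}(G)$ is the minimum $n$ such that there is a graph $H$ with $n$ vertices and a $TT_M$ mapping from $G$ to $H$. -}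

module Defs where

open import Level using (Level; _⊔_)
open import Data.Nat using (ℕ; zero; suc; _≤_)
open import Data.Fin using (Fin; zero; suc; inject₁; fromℕ)
open import Data.Bool using (Bool; if_then_else_)
open import Data.Product using (Σ; _×_)
open import Function using (_∘_)
open import Function.Definitions using (Injective)
open import Relation.Binary.PropositionalEquality using (_≡_; _≢_)
open import Algebra.Bundles using (AbelianGroup; Ring)

record Graph : Set where
  field
    nV  : ℕ
    nE  : ℕ
    src : Fin nE → Fin nV
    tgt : Fin nE → Fin nV
open Graph public

Loopless : Graph → Set
Loopless G = ∀ e → src G e ≢ tgt G e

ProperColouring : (G : Graph) (k : ℕ) → (Fin (nV G) → Fin k) → Set
ProperColouring G k c = ∀ e → c (src G e) ≢ c (tgt G e)

Colourable : Graph → ℕ → Set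
Colourable G k = Σ (Fin (nV G) → Fin k) (ProperColouring G k)

IsChromaticNumber : Graph → ℕ → Set
IsChromaticNumber G k = Colourable G k × (∀ j → Colourable G j → k ≤ j)

-- A circuit (a cycle, connected and 2-regular) together with a direction of
-- traversal: vertices w_0, ..., w_L with w_L = w_0 and w_0..w_{L-1} distinct,
-- distinct edges e_0, ..., e_{L-1} (L ≥ 1), edge e_i joins w_i and w_{i+1};
-- fwd i = true means e_i is traversed forwards (e_i ∈ C⁺), else e_i ∈ C⁻.
-- (L = 1: a loop; L = 2: two parallel edges.)
record Circuit (G : Graph) : Set where
  field
    len     : ℕ   -- the length of the circuit is suc len
    vtx     : Fin (suc (suc len)) → Fin (nV G)
    edg     : Fin (suc len) → Fin (nE G)
    fwd     : Fin (suc len) → Bool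
    closed  : vtx zero ≡ vtx (fromℕ (suc len))
    vtx-inj : Injective _≡_ _≡_ (vtx ∘ inject₁)
    edg-inj : Injective _≡_ _≡_ edg
    joins   : ∀ i → if fwd i
                      then (src G (edg i) ≡ vtx (inject₁ i) × tgt G (edg i) ≡ vtx (suc i))
                      else (src G (edg i) ≡ vtx (suc i) × tgt G (edg i) ≡ vtx (inject₁ i))
open Circuit public

module _ {c ℓ : Level} (A : AbelianGroup c ℓ) where
  open AbelianGroup A

  sumFin : ∀ {n} → (Fin n → Carrier) → Carrier
  sumFin {zero}  f = ε
  sumFin {suc n} f = f zero ∙ sumFin (f ∘ suc)

  IsTension : (G : Graph) → (Fin (nE G) → Carrier) → Set ℓ
  IsTension G τ = (C : Circuit G) →
    sumFin (λ i → if fwd C i then τ (edg C i) else ε)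
      ≈ sumFin (λ i → if fwd C i then ε else τ (edg C i))

  IsTT : (G H : Graph) → (Fin (nE G) → Fin (nE H)) → Set (c ⊔ ℓ)
  IsTT G H f = (τ : Fin (nE H) → Carrier) → IsTension H τ → IsTension G (τ ∘ f)

  IsTTNumber : Graph → ℕ → Set (c ⊔ ℓ)
  IsTTNumber G n =
    Σ Graph (λ H → Loopless H × nV H ≡ n × Σ (Fin (nE G) → Fin (nE H)) (IsTT G H))
    × ((H : Graph) → Loopless H → (f : Fin (nE G) → Fin (nE H)) → IsTT G H f → n ≤ nV H)

module _ {c ℓ : Level} (R : Ring c ℓ) where
  open Ring R

  natMul1 : ℕ → Carrier
  natMul1 zero    = 0#
  natMul1 (suc n) = 1# + natMul1 n

  FiniteRing : Set (c ⊔ ℓ)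
  FiniteRing = Σ ℕ (λ k → Σ (Fin k → Carrier) (λ g → ∀ x → Σ (Fin k) (λ i → g i ≈ x)))

  IsCharacteristic : ℕ → Set ℓ
  IsCharacteristic p = 1 ≤ p × natMul1 p ≈ 0# × (∀ q → 1 ≤ q → natMul1 q ≈ 0# → p ≤ q)

-- For a vertex v of H, differentiating the indicator of v gives a tension of H, which a TT_M map
-- f : E(G) → E(H) pulls back to a tension of G; like every tension it has a potential, built along a
-- spanning forest. This potential lies in ℤ·1 and, read modulo p (the parity for ℤ), becomes a counter
-- r_v(x) ∈ {0, …, p − 1}. Along an edge e of G only the counters of the ends a, b of f(e) move, r_b one
-- step up and r_a one step down, cyclically. Numbering the t vertices of H by 0, …, t − 1, the weight
-- Σ_v v · r_v(x) therefore changes by b − a, b + (p − 1)a, −(a + (p − 1)b) or (p − 1)(a − b): never by 0,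
-- and always by less than N = (t − 1)p + 1 in absolute value. So the weight modulo N is a proper
-- colouring, and χ ≤ N < pt.

module Submission where

open import Defs
open import Level using (Level; _⊔_; 0ℓ) renaming (suc to lsuc)
open import Data.Bool using (Bool; true; false; if_then_else_)
open import Data.Empty using (⊥; ⊥-elim)
open import Data.Fin using (Fin; zero; suc; inject₁; fromℕ; fromℕ<; toℕ; punchIn)
open import Data.Fin.Properties
  using ( fromℕ≢inject₁; inject₁-injective; toℕ-injective; toℕ-fromℕ<; toℕ<n; toℕ≤pred[n]
        ; punchInᵢ≢i; _≟_)
open import Data.Integer as ℤ using (ℤ; +_; -[1+_]; ∣_∣)
open import Data.Integer.Properties using (+-0-abelianGroup)
open import Data.Nat using (ℕ; zero; suc; _+_; _*_; _∸_; _<_; _≤_; z≤n; s≤s; pred; _%_; _/_; NonZero)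
open import Data.Nat.Properties
  using ( ≤-refl; ≤-trans; ≤-<-trans; <-irrefl; <-cmp; <⇒≤; n≤1+n; m≤n⇒m≤1+n; m<1+n⇒m≤n
        ; m<1+n⇒m<n∨m≡n; m≤n⇒m<n∨m≡n; +-mono-≤; *-mono-≤; m≤m*n; m≤n+m; m∸n≤m; m<n⇒0<n∸m
        ; m+[n∸m]≡n; +-comm; +-assoc; *-comm; *-suc; +-cancelʳ-≡; +-cancelˡ-≡; *-cancelʳ-≡
        ; +-0-commutativeMonoid)
open import Data.Nat.DivMod using (m≡m%n+[m/n]*n; [m+kn]%n≡m%n; m<n⇒m%n≡m; m%n<n; n%n≡0)
open import Data.Nat.Tactic.RingSolver using (solve-∀)
open import Data.Product using (Σ; _×_; _,_; proj₁; proj₂)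
open import Data.Sum using (_⊎_; inj₁; inj₂)
open import Data.Unit using (⊤; tt)
open import Data.Vec.Functional using (updateAt)
open import Data.Vec.Functional.Properties using (updateAt-updates; updateAt-minimal)
open import Function using (_∘_)
open import Function.Definitions using (Injective)
open import Relation.Nullary using (¬_; Dec; yes; no)
open import Relation.Binary.Definitions using (tri<; tri≈; tri>)
open import Relation.Binary.PropositionalEquality
  using (_≡_; _≢_; refl; sym; trans; cong; cong₂; subst; subst₂; module ≡-Reasoning)
open import Algebra.Bundles using (AbelianGroup; Ring)
open import Algebra.Properties.CommutativeMonoid.Sum +-0-commutativeMonoid using (sum; sum-remove; sum-cong-≗)
import Algebra.Properties.AbelianGroup as AbelianGroupProperties
import Algebra.Properties.CommutativeSemigroup as CommutativeSemigroupProperties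
import Algebra.Properties.Group as GroupProperties
import Relation.Binary.Reasoning.Setoid as SetoidReasoning

module Paths (G : Graph) where

  Vertex : Set
  Vertex = Fin (nV G)

  Edge : Set
  Edge = Fin (nE G)

  Joins : Edge → Bool → Vertex → Vertex → Set
  Joins e b u v = if b then (src G e ≡ u × tgt G e ≡ v) else (src G e ≡ v × tgt G e ≡ u)

  joins-endpoint : ∀ {e b b′ u v x y} → Joins e b u v → Joins e b′ x y → u ≡ x ⊎ u ≡ y
  joins-endpoint {b = true}  {true}  (s , _) (s′ , _) = inj₁ (trans (sym s) s′)
  joins-endpoint {b = true}  {false} (s , _) (s′ , _) = inj₂ (trans (sym s) s′)
  joins-endpoint {b = false} {true}  (_ , t) (_ , t′) = inj₂ (trans (sym t) t′)
  joins-endpoint {b = false} {false} (_ , t) (_ , t′) = inj₁ (trans (sym t) t′)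

  data Path : ℕ → Vertex → Vertex → Set where
    nil  : ∀ {u} → Path 0 u u
    cons : ∀ {n u v w} (e : Edge) (b : Bool) → Joins e b u v → Path n v w → Path (suc n) u w

  vertexAt : ∀ {n u w} → Path n u w → Fin (suc n) → Vertex
  vertexAt {u = u} p              zero    = u
  vertexAt         (cons _ _ _ p) (suc i) = vertexAt p i

  edgeAt : ∀ {n u w} → Path n u w → Fin n → Edge
  edgeAt (cons e _ _ _) zero    = e
  edgeAt (cons _ _ _ p) (suc i) = edgeAt p i

  forwardAt : ∀ {n u w} → Path n u w → Fin n → Bool
  forwardAt (cons _ b _ _) zero    = b
  forwardAt (cons _ _ _ p) (suc i) = forwardAt p i

  joinsAt : ∀ {n u w} (p : Path n u w) (i : Fin n) →
            Joins (edgeAt p i) (forwardAt p i) (vertexAt p (inject₁ i)) (vertexAt p (suc i))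
  joinsAt (cons _ _ j _) zero    = j
  joinsAt (cons _ _ _ p) (suc i) = joinsAt p i

  vertexAt-last : ∀ {n u w} (p : Path n u w) → vertexAt p (fromℕ n) ≡ w
  vertexAt-last nil            = refl
  vertexAt-last (cons _ _ _ p) = vertexAt-last p

  Avoids : Vertex → ∀ {n u w} → Path n u w → Set
  Avoids z (nil {u})              = u ≢ z
  Avoids z (cons {u = u} _ _ _ p) = u ≢ z × Avoids z p

  Simple : ∀ {n u w} → Path n u w → Set
  Simple nil                    = ⊤
  Simple (cons {u = u} _ _ _ p) = Avoids u p × Simple p

  vertexAt-avoids : ∀ {z n u w} (p : Path n u w) → Avoids z p → ∀ i → vertexAt p i ≢ z
  vertexAt-avoids nil            u≢z       zero    = u≢z
  vertexAt-avoids (cons _ _ _ p) (u≢z , _) zero    = u≢z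
  vertexAt-avoids (cons _ _ _ p) (_ , av)  (suc i) = vertexAt-avoids p av i

  end-avoids : ∀ {z n u w} (p : Path n u w) → Avoids z p → w ≢ z
  end-avoids {n = n} p av w≡z = vertexAt-avoids p av (fromℕ n) (trans (vertexAt-last p) w≡z)

  vertexAt-injective : ∀ {n u w} (p : Path n u w) → Simple p → Injective _≡_ _≡_ (vertexAt p)
  vertexAt-injective p              s        {zero}  {zero}  _  = refl
  vertexAt-injective (cons _ _ _ p) (av , _) {zero}  {suc j} eq = ⊥-elim (vertexAt-avoids p av j (sym eq))
  vertexAt-injective (cons _ _ _ p) (av , _) {suc i} {zero}  eq = ⊥-elim (vertexAt-avoids p av i eq)
  vertexAt-injective (cons _ _ _ p) (_ , s)  {suc i} {suc j} eq = cong suc (vertexAt-injective p s eq)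

  edgeAt-injective : ∀ {n u w} (p : Path n u w) → Simple p → Injective _≡_ _≡_ (edgeAt p)
  edgeAt-injective (cons _ _ _ _) _        {zero}  {zero}  _  = refl
  edgeAt-injective (cons e b j p) (av , _) {zero}  {suc i} eq
    with joins-endpoint (subst (λ e′ → Joins e′ b _ _) eq j) (joinsAt p i)
  ... | inj₁ u≡x = ⊥-elim (vertexAt-avoids p av (inject₁ i) (sym u≡x))
  ... | inj₂ u≡y = ⊥-elim (vertexAt-avoids p av (suc i) (sym u≡y))
  edgeAt-injective (cons e b j p) s        {suc i} {zero}  eq = sym (edgeAt-injective (cons e b j p) s (sym eq))
  edgeAt-injective (cons _ _ _ p) (_ , s)  {suc i} {suc j} eq = cong suc (edgeAt-injective p s eq)

  AllEdges : (Edge → Set) → ∀ {n u w} → Path n u w → Set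
  AllEdges Q nil            = ⊤
  AllEdges Q (cons e _ _ p) = Q e × AllEdges Q p

  AllVertices : (Vertex → Set) → ∀ {n u w} → Path n u w → Set
  AllVertices Q (nil {u})              = Q u
  AllVertices Q (cons {u = u} _ _ _ p) = Q u × AllVertices Q p

  allEdges-edgeAt : ∀ {Q n u w} (p : Path n u w) → AllEdges Q p → ∀ i → Q (edgeAt p i)
  allEdges-edgeAt (cons _ _ _ _) (q , _)  zero    = q
  allEdges-edgeAt (cons _ _ _ p) (_ , qs) (suc i) = allEdges-edgeAt p qs i

  allEdges-map : ∀ {Q R : Edge → Set} → (∀ {e} → Q e → R e) →
                 ∀ {n u w} (p : Path n u w) → AllEdges Q p → AllEdges R p
  allEdges-map f nil            _        = tt
  allEdges-map f (cons _ _ _ p) (q , qs) = f q , allEdges-map f p qs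

  allVertices-map : ∀ {Q R : Vertex → Set} → (∀ {z} → Q z → R z) →
                    ∀ {n u w} (p : Path n u w) → AllVertices Q p → AllVertices R p
  allVertices-map f nil            q        = f q
  allVertices-map f (cons _ _ _ p) (q , qs) = f q , allVertices-map f p qs

  _++_ : ∀ {m n u v w} → Path m u v → Path n v w → Path (m + n) u w
  nil          ++ q = q
  cons e b j p ++ q = cons e b j (p ++ q)

  allEdges-++ : ∀ {Q m n u v w} (p : Path m u v) (q : Path n v w) →
                AllEdges Q p → AllEdges Q q → AllEdges Q (p ++ q)
  allEdges-++ nil            q _         qs′ = qs′
  allEdges-++ (cons _ _ _ p) q (x , qs) qs′ = x , allEdges-++ p q qs qs′

  allVertices-++ : ∀ {Q m n u v w} (p : Path m u v) (q : Path n v w) →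
                   AllVertices Q p → AllVertices Q q → AllVertices Q (p ++ q)
  allVertices-++ nil            q _         qs′ = qs′
  allVertices-++ (cons _ _ _ p) q (x , qs) qs′ = x , allVertices-++ p q qs qs′

  avoids-++ : ∀ {z m n u v w} (p : Path m u v) (q : Path n v w) →
              Avoids z p → Avoids z q → Avoids z (p ++ q)
  avoids-++ nil            q _         av′ = av′
  avoids-++ (cons _ _ _ p) q (x , av) av′ = x , avoids-++ p q av av′

  avoids-disjoint : ∀ {Q₁ Q₂ : Vertex → Set} → (∀ z → Q₁ z → Q₂ z → ⊥) →
                    ∀ {z n u w} (q : Path n u w) → Q₁ z → AllVertices Q₂ q → Avoids z q
  avoids-disjoint disj nil            q₁ q₂        refl = disj _ q₁ q₂
  avoids-disjoint disj (cons _ _ _ q) q₁ (q₂ , qs) =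
    (λ { refl → disj _ q₁ q₂ }) , avoids-disjoint disj q q₁ qs

  simple-bridge : ∀ {Q₁ Q₂ : Vertex → Set} → (∀ z → Q₁ z → Q₂ z → ⊥) →
                  ∀ {m n x a a′ y} (p : Path m x a) (e : Edge) (b : Bool) (j : Joins e b a a′)
                  (q : Path n a′ y) → Simple p → Simple q →
                  AllVertices Q₁ p → AllVertices Q₂ q → Simple (p ++ cons e b j q)
  simple-bridge disj nil e b j q _ sq q₁ qs₂ = avoids-disjoint disj q q₁ qs₂ , sq
  simple-bridge disj (cons _ _ _ p) e b j q (av , sp) sq (q₁ , qs₁) qs₂ =
    avoids-++ p (cons e b j q) av (end-avoids p av , avoids-disjoint disj q q₁ qs₂) ,
    simple-bridge disj p e b j q sp sq qs₁ qs₂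

  closeCircuit : ∀ {n u v} (e : Edge) (b : Bool) (j : Joins e b u v) (p : Path n v u) →
                 Simple p → (∀ i → edgeAt p i ≢ e) → Circuit G
  closeCircuit {n} e b j p s e∉p = record
    { len = n ; vtx = vertexAt q ; edg = edgeAt q ; fwd = forwardAt q
    ; closed = sym (vertexAt-last q) ; vtx-inj = vertices-distinct ; edg-inj = edges-distinct ; joins = joinsAt q }
    where
    q = cons e b j p
    start-not-revisited : ∀ i → vertexAt p (inject₁ i) ≢ vertexAt q zero
    start-not-revisited i eq = fromℕ≢inject₁ {i = i} (vertexAt-injective p s (trans (vertexAt-last p) (sym eq)))
    vertices-distinct : Injective _≡_ _≡_ (vertexAt q ∘ inject₁)
    vertices-distinct {zero}  {zero}  _  = refl
    vertices-distinct {zero}  {suc j} eq = ⊥-elim (start-not-revisited j (sym eq))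
    vertices-distinct {suc i} {zero}  eq = ⊥-elim (start-not-revisited i eq)
    vertices-distinct {suc i} {suc j} eq = cong suc (inject₁-injective (vertexAt-injective p s eq))
    edges-distinct : Injective _≡_ _≡_ (edgeAt q)
    edges-distinct {zero}  {zero}  _  = refl
    edges-distinct {zero}  {suc j} eq = ⊥-elim (e∉p j (sym eq))
    edges-distinct {suc i} {zero}  eq = ⊥-elim (e∉p i eq)
    edges-distinct {suc i} {suc j} eq = cong suc (edgeAt-injective p s eq)

module Potentials {c ℓ : Level} (A : AbelianGroup c ℓ) (G : Graph) where
  open AbelianGroup A renaming (refl to ≈-refl; sym to ≈-sym; trans to ≈-trans)
  open AbelianGroupProperties A using (∙-cancelˡ; ∙-cancelʳ; xyx⁻¹≈y)
  open CommutativeSemigroupProperties commutativeSemigroup using (xy∙z≈xz∙y; xy∙z≈x∙zy)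
  open SetoidReasoning setoid
  open Paths G

  PotentialAt : (Edge → Carrier) → (Vertex → Carrier) → Edge → Set ℓ
  PotentialAt τ ψ e = ψ (tgt G e) ≈ ψ (src G e) ∙ τ e

  forwardSum backwardSum : ∀ {n} → (Edge → Carrier) → (Fin n → Edge) → (Fin n → Bool) → Carrier
  forwardSum  τ ed fw = sumFin A (λ i → if fw i then τ (ed i) else ε)
  backwardSum τ ed fw = sumFin A (λ i → if fw i then ε else τ (ed i))

  module _ (τ : Edge → Carrier) (ψ : Vertex → Carrier) where

    telescope-step : ∀ b {x₀ x₁ xₗ e} F B → Joins e b x₀ x₁ → PotentialAt τ ψ e →
                     ψ x₁ ∙ F ≈ ψ xₗ ∙ B →
                     ψ x₀ ∙ ((if b then τ e else ε) ∙ F) ≈ ψ xₗ ∙ ((if b then ε else τ e) ∙ B)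
    telescope-step true {x₀} {x₁} {xₗ} {e} F B (refl , refl) pot ih = begin
      ψ x₀ ∙ (τ e ∙ F)  ≈⟨ ≈-sym (assoc _ _ _) ⟩
      (ψ x₀ ∙ τ e) ∙ F  ≈⟨ ∙-congʳ (≈-sym pot) ⟩
      ψ x₁ ∙ F          ≈⟨ ih ⟩
      ψ xₗ ∙ B          ≈⟨ ∙-congˡ (≈-sym (identityˡ B)) ⟩
      ψ xₗ ∙ (ε ∙ B)    ∎
    telescope-step false {x₀} {x₁} {xₗ} {e} F B (refl , refl) pot ih = begin
      ψ x₀ ∙ (ε ∙ F)    ≈⟨ ∙-congˡ (identityˡ F) ⟩
      ψ x₀ ∙ F          ≈⟨ ∙-congʳ pot ⟩
      (ψ x₁ ∙ τ e) ∙ F  ≈⟨ xy∙z≈xz∙y _ _ _ ⟩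
      (ψ x₁ ∙ F) ∙ τ e  ≈⟨ ∙-congʳ ih ⟩
      (ψ xₗ ∙ B) ∙ τ e  ≈⟨ xy∙z≈x∙zy _ _ _ ⟩
      ψ xₗ ∙ (τ e ∙ B)  ∎

    telescope : ∀ n (vt : Fin (suc n) → Vertex) (ed : Fin n → Edge) (fw : Fin n → Bool) →
                (∀ i → Joins (ed i) (fw i) (vt (inject₁ i)) (vt (suc i))) →
                (∀ i → PotentialAt τ ψ (ed i)) →
                ψ (vt zero) ∙ forwardSum τ ed fw ≈ ψ (vt (fromℕ n)) ∙ backwardSum τ ed fw
    telescope zero    vt ed fw joins pot = ≈-refl
    telescope (suc n) vt ed fw joins pot =
      telescope-step (fw zero) _ _ (joins zero) (pot zero)
        (telescope n (vt ∘ suc) (ed ∘ suc) (fw ∘ suc) (joins ∘ suc) (pot ∘ suc))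

  difference-isTension : (φ : Vertex → Carrier) → IsTension A G (λ e → φ (tgt G e) ∙ φ (src G e) ⁻¹)
  difference-isTension φ C = ∙-cancelˡ (φ (vtx C zero)) _ _ (begin
    φ (vtx C zero) ∙ forwardSum τ (edg C) (fwd C)
      ≈⟨ telescope τ φ (suc (len C)) (vtx C) (edg C) (fwd C) (joins C) pot ⟩
    φ (vtx C (fromℕ (suc (len C)))) ∙ backwardSum τ (edg C) (fwd C)
      ≡⟨ cong (λ x → φ x ∙ backwardSum τ (edg C) (fwd C)) (sym (closed C)) ⟩
    φ (vtx C zero) ∙ backwardSum τ (edg C) (fwd C) ∎)
    where
    τ : Edge → Carrier
    τ e = φ (tgt G e) ∙ φ (src G e) ⁻¹
    pot : ∀ i → PotentialAt τ φ (edg C i)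
    pot i = ≈-sym (≈-trans (≈-sym (assoc _ _ _)) (xyx⁻¹≈y _ _))

  potential-closes-circuit : ∀ {n} (τ : Edge → Carrier) (ψ : Vertex → Carrier) →
                             IsTension A G τ → (e : Edge) (p : Path n (tgt G e) (src G e)) →
                             Simple p → (∀ i → edgeAt p i ≢ e) →
                             (∀ i → PotentialAt τ ψ (edgeAt p i)) → PotentialAt τ ψ e
  potential-closes-circuit {n} τ ψ tension e p simple e∉p pot = ∙-cancelʳ F _ _ (begin
    ψ (tgt G e) ∙ F              ≈⟨ telescope τ ψ n (vertexAt p) (edgeAt p) (forwardAt p) (joinsAt p) pot ⟩
    ψ (vertexAt p (fromℕ n)) ∙ B ≡⟨ cong (λ x → ψ x ∙ B) (vertexAt-last p) ⟩
    ψ (src G e) ∙ B              ≈⟨ ∙-congˡ (≈-sym (identityˡ B)) ⟩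
    ψ (src G e) ∙ (ε ∙ B)        ≈⟨ ∙-congˡ (≈-sym (tension (closeCircuit e true (refl , refl) p simple e∉p))) ⟩
    ψ (src G e) ∙ (τ e ∙ F)      ≈⟨ ≈-sym (assoc _ _ _) ⟩
    (ψ (src G e) ∙ τ e) ∙ F      ∎)
    where
    F = forwardSum τ (edgeAt p) (forwardAt p)
    B = backwardSum τ (edgeAt p) (forwardAt p)

record Subgroup {c ℓ : Level} (A : AbelianGroup c ℓ) (q : Level) : Set (c ⊔ lsuc q) where
  open AbelianGroup A
  field
    Member    : Carrier → Set q
    ε-member  : Member ε
    ∙-member  : ∀ {x y} → Member x → Member y → Member (x ∙ y)
    ⁻¹-member : ∀ {x} → Member x → Member (x ⁻¹)

-- Edges are added in index order, maintaining a potential of the edges added so far and a map rep to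
-- representatives of their components, with simple connecting paths inside each component. An edge
-- within a component closes a circuit, so the tension condition makes the potential fit it; an edge
-- joining two components is fitted by translating the potential on one of them.
module TensionPotential {c ℓ q : Level} (A : AbelianGroup c ℓ) (S : Subgroup A q) (G : Graph)
  (τ : Fin (nE G) → AbelianGroup.Carrier A) (τ-member : ∀ e → Subgroup.Member S (τ e))
  (tension : IsTension A G τ) where
  open AbelianGroup A renaming (refl to ≈-refl; sym to ≈-sym; trans to ≈-trans)
  open CommutativeSemigroupProperties commutativeSemigroup using (xy∙z≈xz∙y)
  open SetoidReasoning setoid
  open Subgroup S
  open Paths G
  open Potentials A G

  Below : ℕ → Edge → Set
  Below k e = toℕ e < k

  record Linked (k : ℕ) (rep : Vertex → Vertex) (x y : Vertex) : Set where
    constructor linked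
    field
      length      : ℕ
      path        : Path length x y
      simple      : Simple path
      edges-below : AllEdges (Below k) path
      within      : AllVertices (λ z → rep z ≡ rep x) path

  relink : ∀ {k k′ rep rep′ x y} → (∀ {e} → Below k e → Below k′ e) →
           (∀ {z w} → rep z ≡ rep w → rep′ z ≡ rep′ w) → Linked k rep x y → Linked k′ rep′ x y
  relink below same (linked n p s eb w) =
    linked n p s (allEdges-map below p eb) (allVertices-map same p w)

  record PartialPotential (k : ℕ) : Set (c ⊔ ℓ ⊔ q) where
    field
      ψ               : Vertex → Carrier
      ψ-member        : ∀ x → Member (ψ x)
      rep             : Vertex → Vertex
      potential-below : ∀ e → Below k e → PotentialAt τ ψ e
      rep-below       : ∀ e → Below k e → rep (src G e) ≡ rep (tgt G e)
      link            : ∀ x y → rep x ≡ rep y → Linked k rep x y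

  empty : PartialPotential 0
  empty = record
    { ψ = λ _ → ε ; ψ-member = λ _ → ε-member ; rep = λ x → x
    ; potential-below = λ _ () ; rep-below = λ _ ()
    ; link = λ { x .x refl → linked 0 nil tt tt refl } }

  module Extend {k : ℕ} (I : PartialPotential k) (k<m : k < nE G) where
    open PartialPotential I

    new : Edge
    new = fromℕ< k<m

    below-suc : ∀ {e} → Below (suc k) e → Below k e ⊎ e ≡ new
    below-suc {e} lt with m<1+n⇒m<n∨m≡n lt
    ... | inj₁ lt′ = inj₁ lt′
    ... | inj₂ eq  = inj₂ (toℕ-injective (trans eq (sym (toℕ-fromℕ< k<m))))

    new-not-below : ∀ {e} → Below k e → e ≢ new
    new-not-below lt refl = <-irrefl (toℕ-fromℕ< k<m) lt

    new-below : Below (suc k) new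
    new-below rewrite toℕ-fromℕ< k<m = ≤-refl

    module Closing (same : rep (src G new) ≡ rep (tgt G new)) where

      potential-new : PotentialAt τ ψ new
      potential-new with link (tgt G new) (src G new) (sym same)
      ... | linked n p s eb _ = potential-closes-circuit τ ψ tension new p s
              (λ i → new-not-below (allEdges-edgeAt p eb i))
              (λ i → potential-below (edgeAt p i) (allEdges-edgeAt p eb i))

      extended : PartialPotential (suc k)
      extended = record
        { ψ = ψ ; ψ-member = ψ-member ; rep = rep
        ; potential-below = potential-below′ ; rep-below = rep-below′
        ; link = λ x y eq → relink m≤n⇒m≤1+n (λ eq → eq) (link x y eq) }
        where
        potential-below′ : ∀ e → Below (suc k) e → PotentialAt τ ψ e
        potential-below′ e lt with below-suc lt
        ... | inj₁ lt′ = potential-below e lt′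
        ... | inj₂ refl = potential-new
        rep-below′ : ∀ e → Below (suc k) e → rep (src G e) ≡ rep (tgt G e)
        rep-below′ e lt with below-suc lt
        ... | inj₁ lt′ = rep-below e lt′
        ... | inj₂ refl = same

    module Merging (apart : rep (src G new) ≢ rep (tgt G new)) where

      merge : Vertex → Vertex
      merge c with c ≟ rep (tgt G new)
      ... | yes _ = rep (src G new)
      ... | no  _ = c

      merge-tgt : merge (rep (tgt G new)) ≡ rep (src G new)
      merge-tgt with rep (tgt G new) ≟ rep (tgt G new)
      ... | yes _ = refl
      ... | no ne = ⊥-elim (ne refl)

      merge-other : ∀ {c} → c ≢ rep (tgt G new) → merge c ≡ c
      merge-other {c} ne with c ≟ rep (tgt G new)
      ... | yes eq = ⊥-elim (ne eq)
      ... | no  _  = refl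

      shift : Carrier
      shift = ψ (tgt G new) ⁻¹ ∙ (ψ (src G new) ∙ τ new)

      ψ′ : Vertex → Carrier
      ψ′ z with rep z ≟ rep (tgt G new)
      ... | yes _ = ψ z ∙ shift
      ... | no  _ = ψ z

      ψ′-moved : ∀ {z} → rep z ≡ rep (tgt G new) → ψ′ z ≈ ψ z ∙ shift
      ψ′-moved {z} moved with rep z ≟ rep (tgt G new)
      ... | yes _     = ≈-refl
      ... | no  fixed = ⊥-elim (fixed moved)

      ψ′-fixed : ∀ {z} → rep z ≢ rep (tgt G new) → ψ′ z ≈ ψ z
      ψ′-fixed {z} fixed with rep z ≟ rep (tgt G new)
      ... | yes moved = ⊥-elim (fixed moved)
      ... | no  _     = ≈-refl

      ψ′-member : ∀ z → Member (ψ′ z)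
      ψ′-member z with rep z ≟ rep (tgt G new)
      ... | yes _ = ∙-member (ψ-member z)
                      (∙-member (⁻¹-member (ψ-member _)) (∙-member (ψ-member _) (τ-member new)))
      ... | no  _ = ψ-member z

      potential-below′ : ∀ e → Below (suc k) e → PotentialAt τ ψ′ e
      potential-below′ e lt with below-suc lt
      ... | inj₂ refl = begin
        ψ′ (tgt G new)                                       ≈⟨ ψ′-moved refl ⟩
        ψ (tgt G new) ∙ (ψ (tgt G new) ⁻¹ ∙ (ψ (src G new) ∙ τ new)) ≈⟨ ≈-sym (assoc _ _ _) ⟩
        (ψ (tgt G new) ∙ ψ (tgt G new) ⁻¹) ∙ (ψ (src G new) ∙ τ new) ≈⟨ ∙-congʳ (inverseʳ _) ⟩
        ε ∙ (ψ (src G new) ∙ τ new)                          ≈⟨ identityˡ _ ⟩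
        ψ (src G new) ∙ τ new                                ≈⟨ ∙-congʳ (≈-sym (ψ′-fixed apart)) ⟩
        ψ′ (src G new) ∙ τ new                               ∎
      ... | inj₁ lt′ = potential-old lt′ (rep (src G e) ≟ rep (tgt G new))
        where
        potential-old : Below k e → Dec (rep (src G e) ≡ rep (tgt G new)) → PotentialAt τ ψ′ e
        potential-old lt′ (yes moved) = begin
          ψ′ (tgt G e)                ≈⟨ ψ′-moved (trans (sym (rep-below e lt′)) moved) ⟩
          ψ (tgt G e) ∙ shift         ≈⟨ ∙-congʳ (potential-below e lt′) ⟩
          (ψ (src G e) ∙ τ e) ∙ shift ≈⟨ xy∙z≈xz∙y _ _ _ ⟩
          (ψ (src G e) ∙ shift) ∙ τ e ≈⟨ ∙-congʳ (≈-sym (ψ′-moved moved)) ⟩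
          ψ′ (src G e) ∙ τ e          ∎
        potential-old lt′ (no fixed) = begin
          ψ′ (tgt G e)       ≈⟨ ψ′-fixed (λ moved → fixed (trans (rep-below e lt′) moved)) ⟩
          ψ (tgt G e)        ≈⟨ potential-below e lt′ ⟩
          ψ (src G e) ∙ τ e  ≈⟨ ∙-congʳ (≈-sym (ψ′-fixed fixed)) ⟩
          ψ′ (src G e) ∙ τ e ∎


      rep-below′ : ∀ e → Below (suc k) e → merge (rep (src G e)) ≡ merge (rep (tgt G e))
      rep-below′ e lt with below-suc lt
      ... | inj₁ lt′  = cong merge (rep-below e lt′)
      ... | inj₂ refl = trans (merge-other apart) (sym merge-tgt)

      bridge : ∀ {x a a′ y} (b : Bool) → Joins new b a a′ → rep x ≡ rep a → rep a′ ≡ rep y →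
               rep a ≢ rep a′ → merge (rep a) ≡ merge (rep a′) → Linked (suc k) (merge ∘ rep) x y
      bridge {x} {a} {a′} {y} b j xa a′y a≁a′ merged with link x a xa | link a′ y a′y
      ... | linked n₁ p₁ s₁ eb₁ w₁ | linked n₂ p₂ s₂ eb₂ w₂ =
        linked (n₁ + suc n₂) (p₁ ++ crossing)
          (simple-bridge disjoint p₁ new b j p₂ s₁ s₂ w₁ w₂)
          (allEdges-++ p₁ crossing (allEdges-map m≤n⇒m≤1+n p₁ eb₁)
            (new-below , allEdges-map m≤n⇒m≤1+n p₂ eb₂))
          (allVertices-++ p₁ crossing (allVertices-map (cong merge) p₁ w₁)
            (cong merge (sym xa) , allVertices-map second p₂ w₂))
        where
        crossing : Path (suc n₂) a y
        crossing = cons new b j p₂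
        disjoint : ∀ z → rep z ≡ rep x → rep z ≡ rep a′ → ⊥
        disjoint z zx za′ = a≁a′ (trans (sym xa) (trans (sym zx) za′))
        second : ∀ {z} → rep z ≡ rep a′ → merge (rep z) ≡ merge (rep x)
        second za′ = trans (cong merge za′) (trans (sym merged) (cong merge (sym xa)))

      link′ : ∀ x y → merge (rep x) ≡ merge (rep y) → Linked (suc k) (merge ∘ rep) x y
      link′ x y merged = by-components (rep x ≟ rep (tgt G new)) (rep y ≟ rep (tgt G new))
        where
        by-components : Dec (rep x ≡ rep (tgt G new)) → Dec (rep y ≡ rep (tgt G new)) →
                        Linked (suc k) (merge ∘ rep) x y
        by-components (yes x-moved) (yes y-moved) =
          relink m≤n⇒m≤1+n (cong merge) (link x y (trans x-moved (sym y-moved)))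
        by-components (no x-fixed) (no y-fixed) =
          relink m≤n⇒m≤1+n (cong merge)
            (link x y (trans (sym (merge-other x-fixed)) (trans merged (merge-other y-fixed))))
        by-components (yes x-moved) (no y-fixed) =
          bridge false (refl , refl) x-moved
            (trans (sym merge-tgt) (trans (cong merge (sym x-moved)) (trans merged (merge-other y-fixed))))
            (λ eq → apart (sym eq)) (trans merge-tgt (sym (merge-other apart)))
        by-components (no x-fixed) (yes y-moved) =
          bridge true (refl , refl)
            (trans (sym (merge-other x-fixed)) (trans merged (trans (cong merge y-moved) merge-tgt)))
            (sym y-moved) apart (trans (merge-other apart) (sym merge-tgt))

      extended : PartialPotential (suc k)
      extended = record
        { ψ = ψ′ ; ψ-member = ψ′-member ; rep = merge ∘ rep
        ; potential-below = potential-below′ ; rep-below = rep-below′ ; link = link′ }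

    extended : PartialPotential (suc k)
    extended with rep (src G new) ≟ rep (tgt G new)
    ... | yes same  = Closing.extended same
    ... | no  apart = Merging.extended apart

  partialPotential : ∀ k → k ≤ nE G → PartialPotential k
  partialPotential zero    _   = empty
  partialPotential (suc k) k<m = Extend.extended (partialPotential k (≤-trans (n≤1+n k) k<m)) k<m

  potential : Σ (Vertex → Carrier) λ ψ → (∀ x → Member (ψ x)) × (∀ e → PotentialAt τ ψ e)
  potential = ψ , ψ-member , λ e → potential-below e (toℕ<n e)
    where open PartialPotential (partialPotential (nE G) ≤-refl)

sum-exchange : ∀ {n} (i : Fin n) (g h : Fin n → ℕ) → (∀ j → j ≢ i → g j ≡ h j) →
               sum g + h i ≡ sum h + g i
sum-exchange {suc n} i g h agree = begin
  sum g + h i                       ≡⟨ cong (_+ h i) (sum-remove g) ⟩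
  (g i + sum (g ∘ punchIn i)) + h i ≡⟨ cong (λ s → (g i + s) + h i) (sum-cong-≗ agree-off-i) ⟩
  (g i + sum (h ∘ punchIn i)) + h i ≡⟨ swap-outer (g i) _ (h i) ⟩
  (h i + sum (h ∘ punchIn i)) + g i ≡⟨ cong (_+ g i) (sum-remove h) ⟨
  sum h + g i                       ∎
  where
  open ≡-Reasoning
  agree-off-i : ∀ j → g (punchIn i j) ≡ h (punchIn i j)
  agree-off-i j = agree _ (punchInᵢ≢i i j)
  swap-outer : ∀ x s y → (x + s) + y ≡ (y + s) + x
  swap-outer = solve-∀

sum-exchange₂ : ∀ {n} {i j : Fin n} → i ≢ j → (g h : Fin n → ℕ) →
                (∀ k → k ≢ i → k ≢ j → g k ≡ h k) → sum g + (h i + h j) ≡ sum h + (g i + g j)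
sum-exchange₂ {n} {i} {j} i≢j g h agree = begin
  sum g + (h i + h j)   ≡⟨ +-assoc (sum g) (h i) (h j) ⟨
  (sum g + h i) + h j   ≡⟨ cong (λ x → (sum g + x) + h j) (updateAt-updates i g) ⟨
  (sum g + mid i) + h j ≡⟨ cong (_+ h j) (sum-exchange i g mid (λ k k≢i → sym (updateAt-minimal k i g k≢i))) ⟩
  (sum mid + g i) + h j ≡⟨ swap-last (sum mid) (g i) (h j) ⟩
  (sum mid + h j) + g i ≡⟨ cong (_+ g i) (sum-exchange j mid h agree-off-j) ⟩
  (sum h + mid j) + g i ≡⟨ cong (λ x → (sum h + x) + g i) (updateAt-minimal j i g (i≢j ∘ sym)) ⟩
  (sum h + g j) + g i   ≡⟨ swap-last (sum h) (g j) (g i) ⟩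
  (sum h + g i) + g j   ≡⟨ +-assoc (sum h) (g i) (g j) ⟩
  sum h + (g i + g j)   ∎
  where
  open ≡-Reasoning
  mid : Fin n → ℕ
  mid = updateAt g i (λ _ → h i)
  agree-off-j : ∀ k → k ≢ j → mid k ≡ h k
  agree-off-j k k≢j with k ≟ i
  ... | yes refl = updateAt-updates i g
  ... | no  k≢i  = trans (updateAt-minimal k i g k≢i) (agree k k≢i k≢j)
  swap-last : ∀ s x y → (s + x) + y ≡ (s + y) + x
  swap-last = solve-∀

data CyclicSuc : ℕ → ℕ → ℕ → Set where
  step : ∀ {p m} → CyclicSuc p m (suc m)
  wrap : ∀ {m} → CyclicSuc (suc m) m 0

suc-% : ∀ p .{{_ : NonZero p}} n → suc n % p ≡ suc (n % p) % p
suc-% p n = trans (cong (λ m → suc m % p) (m≡m%n+[m/n]*n n p)) ([m+kn]%n≡m%n (suc (n % p)) (n / p) p)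

cyclicSuc-% : ∀ p .{{_ : NonZero p}} n → CyclicSuc p (n % p) (suc n % p)
cyclicSuc-% (suc q) n with m≤n⇒m<n∨m≡n (m<1+n⇒m≤n (m%n<n n (suc q)))
... | inj₁ lt = subst (CyclicSuc (suc q) (n % suc q)) (sym (trans (suc-% (suc q) n) (m<n⇒m%n≡m (s≤s lt))))
                  step
... | inj₂ eq = subst₂ (CyclicSuc (suc q)) (sym eq)
                  (sym (trans (suc-% (suc q) n) (trans (cong (λ m → suc m % suc q) eq) (n%n≡0 (suc q)))))
                  wrap

cancel-mod : ∀ {N} .{{_ : NonZero N}} x y {X Y} → x % N ≡ y % N → x + X ≡ y + Y → X < N → Y < N → X ≡ Y
cancel-mod {N} x y {X} {Y} x≡y eq X<N Y<N = begin
  X                     ≡⟨ m<n⇒m%n≡m X<N ⟨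
  X % N                 ≡⟨ [m+kn]%n≡m%n X (x / N) N ⟨
  (X + (x / N) * N) % N ≡⟨ cong (_% N) quotients ⟩
  (Y + (y / N) * N) % N ≡⟨ [m+kn]%n≡m%n Y (y / N) N ⟩
  Y % N                 ≡⟨ m<n⇒m%n≡m Y<N ⟩
  Y                     ∎
  where
  open ≡-Reasoning
  rearrange : ∀ r Z k → r + (Z + k) ≡ (r + k) + Z
  rearrange = solve-∀
  quotients : X + (x / N) * N ≡ Y + (y / N) * N
  quotients = +-cancelˡ-≡ (x % N) _ _ (begin
    x % N + (X + (x / N) * N) ≡⟨ rearrange (x % N) X _ ⟩
    (x % N + (x / N) * N) + X ≡⟨ cong (_+ X) (m≡m%n+[m/n]*n x N) ⟨
    x + X                     ≡⟨ eq ⟩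
    y + Y                     ≡⟨ cong (_+ Y) (m≡m%n+[m/n]*n y N) ⟩
    (y % N + (y / N) * N) + Y ≡⟨ rearrange (y % N) Y _ ⟨
    y % N + (Y + (y / N) * N) ≡⟨ cong (_+ (Y + (y / N) * N)) x≡y ⟨
    x % N + (Y + (y / N) * N) ∎)

module Separation (T q : ℕ) where

  p N : ℕ
  p = suc (suc q)
  N = suc (T * p)

  T*p≡T+T*[1+q] : T * p ≡ T + T * suc q
  T*p≡T+T*[1+q] = *-suc T (suc q)

  <N : ∀ {a} → a ≤ T → a < N
  <N a≤T = s≤s (≤-trans a≤T (m≤m*n T p))

  offset<N : ∀ {a b} → a ≤ T → b ≤ T → b + a * suc q < N
  offset<N {a} {b} a≤T b≤T =
    s≤s (subst (b + a * suc q ≤_) (sym T*p≡T+T*[1+q]) (+-mono-≤ b≤T (*-mono-≤ a≤T ≤-refl)))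

  scaled<N : ∀ {a} → a ≤ T → a * suc q < N
  scaled<N {a} a≤T =
    s≤s (subst (a * suc q ≤_) (sym T*p≡T+T*[1+q]) (≤-trans (*-mono-≤ a≤T ≤-refl) (m≤n+m _ T)))

  offset≢0 : ∀ {a b} → a ≢ b → b + a * suc q ≢ 0
  offset≢0 {zero}  {zero}  a≢b _ = a≢b refl
  offset≢0 {suc _} {zero}  _ ()
  offset≢0 {_}     {suc _} _ ()

  colours-differ : ∀ sx sy {a b rA rA′ rB rB′} → a ≢ b → a ≤ T → b ≤ T →
                   sx + (a * rA′ + b * rB′) ≡ sy + (a * rA + b * rB) →
                   CyclicSuc p rB rB′ → CyclicSuc p rA′ rA → sx % N ≢ sy % N
  colours-differ sx sy {a} {b} {_} {rA′} {rB} a≢b a≤T b≤T eq step step same =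
    a≢b (sym (cancel-mod sx sy same shifted (<N b≤T) (<N a≤T)))
    where
    lhs : ∀ sx b a rA′ rB → (sx + b) + (a * rA′ + b * rB) ≡ sx + (a * rA′ + b * suc rB)
    lhs = solve-∀
    rhs : ∀ sy a rA′ b rB → sy + (a * suc rA′ + b * rB) ≡ (sy + a) + (a * rA′ + b * rB)
    rhs = solve-∀
    shifted : sx + b ≡ sy + a
    shifted = +-cancelʳ-≡ (a * rA′ + b * rB) _ _ (trans (lhs sx b a rA′ rB) (trans eq (rhs sy a rA′ b rB)))
  colours-differ sx sy {a} {b} {_} {_} {rB} a≢b a≤T b≤T eq step wrap same =
    offset≢0 a≢b (cancel-mod sx sy same shifted (offset<N a≤T b≤T) (s≤s z≤n))
    where
    lhs : ∀ sx a b rB → (sx + (b + a * suc q)) + b * rB ≡ sx + (a * suc q + b * suc rB)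
    lhs = solve-∀
    rhs : ∀ sy a b rB → sy + (a * 0 + b * rB) ≡ (sy + 0) + b * rB
    rhs = solve-∀
    shifted : sx + (b + a * suc q) ≡ sy + 0
    shifted = +-cancelʳ-≡ (b * rB) _ _ (trans (lhs sx a b rB) (trans eq (rhs sy a b rB)))
  colours-differ sx sy {a} {b} {_} {rA′} a≢b a≤T b≤T eq wrap step same =
    offset≢0 (a≢b ∘ sym) (sym (cancel-mod sx sy same shifted (s≤s z≤n) (offset<N b≤T a≤T)))
    where
    lhs : ∀ sx a rA′ b → (sx + 0) + a * rA′ ≡ sx + (a * rA′ + b * 0)
    lhs = solve-∀
    rhs : ∀ sy a rA′ b → sy + (a * suc rA′ + b * suc q) ≡ (sy + (a + b * suc q)) + a * rA′
    rhs = solve-∀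
    shifted : sx + 0 ≡ sy + (a + b * suc q)
    shifted = +-cancelʳ-≡ (a * rA′) _ _ (trans (lhs sx a rA′ b) (trans eq (rhs sy a rA′ b)))
  colours-differ sx sy {a} {b} a≢b a≤T b≤T eq wrap wrap same =
    a≢b (*-cancelʳ-≡ a b (suc q) (cancel-mod sx sy same shifted (scaled<N a≤T) (scaled<N b≤T)))
    where
    lhs : ∀ sx a b → sx + a * suc q ≡ sx + (a * suc q + b * 0)
    lhs = solve-∀
    rhs : ∀ sy a b → sy + (a * 0 + b * suc q) ≡ sy + b * suc q
    rhs = solve-∀
    shifted : sx + a * suc q ≡ sy + b * suc q
    shifted = trans (lhs sx a b) (trans eq (rhs sy a b))

module CounterColouring (G : Graph) (n q : ℕ) where
  open Separation (pred n) q

  counters⇒colourable :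
    (a b : Fin (nE G) → Fin n) → (∀ e → a e ≢ b e) →
    (r : Fin n → Fin (nV G) → ℕ) →
    (∀ e v → v ≢ a e → v ≢ b e → r v (src G e) ≡ r v (tgt G e)) →
    (∀ e → CyclicSuc p (r (b e) (src G e)) (r (b e) (tgt G e))) →
    (∀ e → CyclicSuc p (r (a e) (tgt G e)) (r (a e) (src G e))) →
    Colourable G N
  counters⇒colourable a b a≢b r fixed up down = colour , proper
    where
    weight : Fin (nV G) → ℕ
    weight x = sum (λ v → toℕ v * r v x)
    colour : Fin (nV G) → Fin N
    colour x = fromℕ< (m%n<n (weight x) N)
    proper : ProperColouring G N colour
    proper e same-colour =
      colours-differ (weight x) (weight y) (a≢b e ∘ toℕ-injective) (toℕ≤pred[n] (a e)) (toℕ≤pred[n] (b e))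
        exchange (up e) (down e) same-residue
      where
      x = src G e
      y = tgt G e
      exchange : weight x + (toℕ (a e) * r (a e) y + toℕ (b e) * r (b e) y)
               ≡ weight y + (toℕ (a e) * r (a e) x + toℕ (b e) * r (b e) x)
      exchange = sum-exchange₂ (a≢b e) (λ v → toℕ v * r v x) (λ v → toℕ v * r v y)
                   (λ v v≢a v≢b → cong (toℕ v *_) (fixed e v v≢a v≢b))
      same-residue : weight x % N ≡ weight y % N
      same-residue = trans (sym (toℕ-fromℕ< _)) (trans (cong toℕ same-colour) (toℕ-fromℕ< _))

record CyclicCounter {c ℓ : Level} (A : AbelianGroup c ℓ) (p : ℕ) (q : Level) : Set (c ⊔ ℓ ⊔ lsuc q) where
  open AbelianGroup A
  field
    subgroup : Subgroup A q
  open Subgroup subgroup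
  field
    unit        : Carrier
    unit-member : Member unit
    count       : ∀ {x} → Member x → ℕ
    count-cong  : ∀ {x y} (mx : Member x) (my : Member y) → x ≈ y → count mx ≡ count my
    count-suc   : ∀ {x y} (mx : Member x) (my : Member y) → y ≈ x ∙ unit → CyclicSuc p (count mx) (count my)

module TTColouring {c ℓ q : Level} (A : AbelianGroup c ℓ) (q′ : ℕ) (K : CyclicCounter A (suc (suc q′)) q) where
  open AbelianGroup A renaming (refl to ≈-refl; sym to ≈-sym; trans to ≈-trans)
  open AbelianGroupProperties A using (ε⁻¹≈ε)
  open SetoidReasoning setoid
  open CyclicCounter K
  open Subgroup subgroup

  p : ℕ
  p = suc (suc q′)

  module _ (G H : Graph) (loopless : Loopless H) (f : Fin (nE G) → Fin (nE H)) (continuous : IsTT A G H f) where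

    indicator : Fin (nV H) → Fin (nV H) → Carrier
    indicator v w with w ≟ v
    ... | yes _ = unit
    ... | no  _ = ε

    indicator-at : ∀ v → indicator v v ≡ unit
    indicator-at v with v ≟ v
    ... | yes _  = refl
    ... | no v≢v = ⊥-elim (v≢v refl)

    indicator-away : ∀ {v w} → w ≢ v → indicator v w ≡ ε
    indicator-away {v} {w} w≢v with w ≟ v
    ... | yes w≡v = ⊥-elim (w≢v w≡v)
    ... | no  _   = refl

    indicator-member : ∀ v w → Member (indicator v w)
    indicator-member v w with w ≟ v
    ... | yes _ = unit-member
    ... | no  _ = ε-member

    δ : Fin (nV H) → Fin (nE H) → Carrier
    δ v e = indicator v (tgt H e) ∙ indicator v (src H e) ⁻¹

    δ-away : ∀ {v e} → v ≢ src H e → v ≢ tgt H e → δ v e ≈ ε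
    δ-away {v} {e} v≢s v≢t = begin
      indicator v (tgt H e) ∙ indicator v (src H e) ⁻¹
        ≡⟨ cong₂ (λ x y → x ∙ y ⁻¹) (indicator-away (v≢t ∘ sym)) (indicator-away (v≢s ∘ sym)) ⟩
      ε ∙ ε ⁻¹ ≈⟨ inverseʳ ε ⟩
      ε        ∎

    δ-tgt : ∀ e → δ (tgt H e) e ≈ unit
    δ-tgt e = begin
      indicator (tgt H e) (tgt H e) ∙ indicator (tgt H e) (src H e) ⁻¹
        ≡⟨ cong₂ (λ x y → x ∙ y ⁻¹) (indicator-at (tgt H e)) (indicator-away (loopless e)) ⟩
      unit ∙ ε ⁻¹ ≈⟨ ∙-congˡ ε⁻¹≈ε ⟩
      unit ∙ ε    ≈⟨ identityʳ unit ⟩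
      unit        ∎

    δ-src : ∀ e → δ (src H e) e ≈ unit ⁻¹
    δ-src e = begin
      indicator (src H e) (tgt H e) ∙ indicator (src H e) (src H e) ⁻¹
        ≡⟨ cong₂ (λ x y → x ∙ y ⁻¹) (indicator-away (loopless e ∘ sym)) (indicator-at (src H e)) ⟩
      ε ∙ unit ⁻¹ ≈⟨ identityˡ _ ⟩
      unit ⁻¹     ∎

    potential : ∀ v → Σ (Fin (nV G) → Carrier) λ ψ →
                (∀ x → Member (ψ x)) × (∀ e → Potentials.PotentialAt A G (δ v ∘ f) ψ e)
    potential v = TensionPotential.potential A subgroup G (δ v ∘ f)
      (λ e → ∙-member (indicator-member v (tgt H (f e))) (⁻¹-member (indicator-member v (src H (f e)))))
      (continuous (δ v) (Potentials.difference-isTension A H (indicator v)))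

    ψ : Fin (nV H) → Fin (nV G) → Carrier
    ψ v = proj₁ (potential v)

    ψ-member : ∀ v x → Member (ψ v x)
    ψ-member v = proj₁ (proj₂ (potential v))

    ψ-potential : ∀ v e → ψ v (tgt G e) ≈ ψ v (src G e) ∙ δ v (f e)
    ψ-potential v = proj₂ (proj₂ (potential v))

    r : Fin (nV H) → Fin (nV G) → ℕ
    r v x = count (ψ-member v x)

    r-fixed : ∀ e v → v ≢ src H (f e) → v ≢ tgt H (f e) → r v (src G e) ≡ r v (tgt G e)
    r-fixed e v v≢s v≢t = count-cong _ _ (begin
      ψ v (src G e)             ≈⟨ identityʳ _ ⟨
      ψ v (src G e) ∙ ε         ≈⟨ ∙-congˡ (δ-away v≢s v≢t) ⟨
      ψ v (src G e) ∙ δ v (f e) ≈⟨ ψ-potential v e ⟨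
      ψ v (tgt G e)             ∎)

    r-up : ∀ e → CyclicSuc p (r (tgt H (f e)) (src G e)) (r (tgt H (f e)) (tgt G e))
    r-up e = count-suc _ _ (begin
      ψ v (tgt G e)             ≈⟨ ψ-potential v e ⟩
      ψ v (src G e) ∙ δ v (f e) ≈⟨ ∙-congˡ (δ-tgt (f e)) ⟩
      ψ v (src G e) ∙ unit      ∎)
      where v = tgt H (f e)

    r-down : ∀ e → CyclicSuc p (r (src H (f e)) (tgt G e)) (r (src H (f e)) (src G e))
    r-down e = count-suc _ _ (begin
      ψ v (src G e)                      ≈⟨ identityʳ _ ⟨
      ψ v (src G e) ∙ ε                  ≈⟨ ∙-congˡ (inverseˡ unit) ⟨
      ψ v (src G e) ∙ (unit ⁻¹ ∙ unit)   ≈⟨ assoc _ _ _ ⟨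
      (ψ v (src G e) ∙ unit ⁻¹) ∙ unit   ≈⟨ ∙-congʳ (∙-congˡ (δ-src (f e))) ⟨
      (ψ v (src G e) ∙ δ v (f e)) ∙ unit ≈⟨ ∙-congʳ (ψ-potential v e) ⟨
      ψ v (tgt G e) ∙ unit               ∎)
      where v = src H (f e)

    ttMap⇒colourable : Colourable G (suc (pred (nV H) * p))
    ttMap⇒colourable = CounterColouring.counters⇒colourable G (nV H) q′
      (src H ∘ f) (tgt H ∘ f) (loopless ∘ f) r r-fixed r-up r-down

  colours<p*n : ∀ {n} → Fin n → suc (pred n * p) < p * n
  colours<p*n {suc T} _ = subst (suc (T * p) <_) (sym (trans (*-suc p T) (cong (λ m → p + m) (*-comm p T))))
                            (s≤s (s≤s (m≤n+m (T * p) q′)))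

  χ<p*t : ∀ G → 0 < nE G → ∀ χ t → IsChromaticNumber G χ → IsTTNumber A G t → χ < p * t
  χ<p*t G edge χ t (_ , minimal) ((H , loopless , nV≡t , f , continuous) , _) =
    ≤-<-trans (minimal _ (ttMap⇒colourable G H loopless f continuous))
      (subst (λ n → suc (pred (nV H) * p) < p * n) nV≡t (colours<p*n (src H (f (fromℕ< edge)))))

module RingCounter {c ℓ : Level} (M : Ring c ℓ) (q′ : ℕ) (char : IsCharacteristic M (suc (suc q′))) where
  open Ring M hiding (_*_)
    renaming (_+_ to _+ᴹ_; +-comm to +ᴹ-comm; +-assoc to +ᴹ-assoc; refl to ≈-refl; sym to ≈-sym; trans to ≈-trans)
  open GroupProperties +-group using (∙-cancelˡ; inverseʳ-unique)
  open SetoidReasoning setoid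

  p : ℕ
  p = suc (suc q′)

  ι : ℕ → Carrier
  ι = natMul1 M

  ι-+ : ∀ m n → ι (m + n) ≈ ι m +ᴹ ι n
  ι-+ zero    n = ≈-sym (+-identityˡ _)
  ι-+ (suc m) n = ≈-trans (+-congˡ (ι-+ m n)) (≈-sym (+ᴹ-assoc _ _ _))

  ι-*p : ∀ k → ι (k * p) ≈ 0#
  ι-*p zero    = ≈-refl
  ι-*p (suc k) = ≈-trans (ι-+ p (k * p)) (≈-trans (+-cong (proj₁ (proj₂ char)) (ι-*p k)) (+-identityʳ 0#))

  ι-% : ∀ n → ι n ≈ ι (n % p)
  ι-% n = begin
    ι n                         ≡⟨ cong ι (m≡m%n+[m/n]*n n p) ⟩
    ι (n % p + (n / p) * p)     ≈⟨ ι-+ (n % p) _ ⟩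
    ι (n % p) +ᴹ ι ((n / p) * p) ≈⟨ +-congˡ (ι-*p (n / p)) ⟩
    ι (n % p) +ᴹ 0#             ≈⟨ +-identityʳ _ ⟩
    ι (n % p)                   ∎

  ι-separates-below : ∀ {m n} → m < n → n < p → ι m ≈ ι n → ⊥
  ι-separates-below {m} {n} m<n n<p ιm≈ιn = <-irrefl refl (≤-<-trans (≤-trans p≤gap (m∸n≤m n m)) n<p)
    where
    gap-vanishes : ι (n ∸ m) ≈ 0#
    gap-vanishes = ∙-cancelˡ (ι m) _ _ (begin
      ι m +ᴹ ι (n ∸ m) ≈⟨ ι-+ m (n ∸ m) ⟨
      ι (m + (n ∸ m))  ≡⟨ cong ι (m+[n∸m]≡n (<⇒≤ m<n)) ⟩
      ι n              ≈⟨ ιm≈ιn ⟨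
      ι m              ≈⟨ +-identityʳ (ι m) ⟨
      ι m +ᴹ 0#        ∎)
    p≤gap : p ≤ n ∸ m
    p≤gap = proj₂ (proj₂ char) (n ∸ m) (m<n⇒0<n∸m m<n) gap-vanishes

  ι-injective-below : ∀ {m n} → m < p → n < p → ι m ≈ ι n → m ≡ n
  ι-injective-below {m} {n} m<p n<p ιm≈ιn with <-cmp m n
  ... | tri< m<n _ _ = ⊥-elim (ι-separates-below m<n n<p ιm≈ιn)
  ... | tri≈ _ m≡n _ = m≡n
  ... | tri> _ _ n<m = ⊥-elim (ι-separates-below n<m m<p (≈-sym ιm≈ιn))

  ι≈⇒%≡ : ∀ m n → ι m ≈ ι n → m % p ≡ n % p
  ι≈⇒%≡ m n eq = ι-injective-below (m%n<n m p) (m%n<n n p) (≈-trans (≈-sym (ι-% m)) (≈-trans eq (ι-% n)))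

  ι-negation : ∀ n → ι n +ᴹ ι (n * suc q′) ≈ 0#
  ι-negation n = begin
    ι n +ᴹ ι (n * suc q′) ≈⟨ ι-+ n (n * suc q′) ⟨
    ι (n + n * suc q′)    ≡⟨ cong ι (*-suc n (suc q′)) ⟨
    ι (n * p)             ≈⟨ ι-*p n ⟩
    0#                    ∎

  Multiple : Carrier → Set ℓ
  Multiple x = Σ ℕ λ n → x ≈ ι n

  multiples : Subgroup +-abelianGroup ℓ
  multiples = record
    { Member    = Multiple
    ; ε-member  = 0 , ≈-refl
    ; ∙-member  = λ { (m , x≈ιm) (n , y≈ιn) → m + n , ≈-trans (+-cong x≈ιm y≈ιn) (≈-sym (ι-+ m n)) }
    ; ⁻¹-member = λ { {x} (n , x≈ιn) → n * suc q′ ,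
        ≈-sym (inverseʳ-unique x _ (≈-trans (+-congʳ x≈ιn) (ι-negation n))) } }

  residue : ∀ {x} → Multiple x → ℕ
  residue (n , _) = n % p

  residue-cong : ∀ {x y} (mx : Multiple x) (my : Multiple y) → x ≈ y → residue mx ≡ residue my
  residue-cong (m , x≈ιm) (n , y≈ιn) x≈y = ι≈⇒%≡ m n (≈-trans (≈-sym x≈ιm) (≈-trans x≈y y≈ιn))

  residue-suc : ∀ {x y} (mx : Multiple x) (my : Multiple y) → y ≈ x +ᴹ 1# → CyclicSuc p (residue mx) (residue my)
  residue-suc {x} {y} (m , x≈ιm) (n , y≈ιn) y≈x+1 =
    subst (CyclicSuc p (m % p)) (sym (ι≈⇒%≡ n (suc m) ιn≈ι[1+m])) (cyclicSuc-% p m)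
    where
    ιn≈ι[1+m] : ι n ≈ ι (suc m)
    ιn≈ι[1+m] = begin
      ι n       ≈⟨ y≈ιn ⟨
      y         ≈⟨ y≈x+1 ⟩
      x +ᴹ 1#   ≈⟨ +-congʳ x≈ιm ⟩
      ι m +ᴹ 1# ≈⟨ +ᴹ-comm _ _ ⟩
      ι (suc m) ∎

  counter : CyclicCounter +-abelianGroup p ℓ
  counter = record
    { subgroup = multiples ; unit = 1# ; unit-member = 1 , ≈-sym (+-identityʳ 1#)
    ; count = residue ; count-cong = residue-cong ; count-suc = residue-suc }

integer-parity-step : ∀ z → CyclicSuc 2 (∣ z ∣ % 2) (∣ z ℤ.+ + 1 ∣ % 2)
integer-parity-step (+ n)          = subst (λ m → CyclicSuc 2 (n % 2) (m % 2)) (+-comm 1 n) (cyclicSuc-% 2 n)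
integer-parity-step -[1+ zero ]    = wrap
integer-parity-step -[1+ suc n ]   = cyclicSuc-% 2 n

integerCounter : CyclicCounter +-0-abelianGroup 2 0ℓ
integerCounter = record
  { subgroup    = record { Member = λ _ → ⊤ ; ε-member = tt ; ∙-member = λ _ _ → tt ; ⁻¹-member = λ _ → tt }
  ; unit        = + 1
  ; unit-member = tt
  ; count       = λ {z} _ → ∣ z ∣ % 2
  ; count-cong  = λ { _ _ refl → refl }
  ; count-suc   = λ { {z} _ _ refl → integer-parity-step z } }

χ<char*t : ∀ {c ℓ} (M : Ring c ℓ) → ¬ (Ring._≈_ M (Ring.1# M) (Ring.0# M)) →
           ∀ p → IsCharacteristic M p → ∀ G → 0 < nE G →
           ∀ χ t → IsChromaticNumber G χ → IsTTNumber (Ring.+-abelianGroup M) G t → χ < p * t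
χ<char*t M _   zero           (() , _)
χ<char*t M 1≉0 (suc zero)     (_ , 1+0≈0 , _) =
  ⊥-elim (1≉0 (Ring.trans M (Ring.sym M (Ring.+-identityʳ M _)) 1+0≈0))
χ<char*t M _   (suc (suc q′)) char = TTColouring.χ<p*t (Ring.+-abelianGroup M) q′ (RingCounter.counter M q′ char)

corollary39 : ∀ {c ℓ : Level} →
    (∀ (M : Ring c ℓ) → FiniteRing M → ¬ (Ring._≈_ M (Ring.1# M) (Ring.0# M)) →
      ∀ (p : ℕ) → IsCharacteristic M p →
      ∀ (G : Graph) → Loopless G → 0 < nE G →
      ∀ (χ t : ℕ) → IsChromaticNumber G χ → IsTTNumber (Ring.+-abelianGroup M) G t →
      χ < p * t)
    ×
    (∀ (G : Graph) → Loopless G → 0 < nE G →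
      ∀ (χ t : ℕ) → IsChromaticNumber G χ → IsTTNumber +-0-abelianGroup G t →
      χ < 2 * t)
corollary39 =
  (λ M _ 1≉0 p char G _ → χ<char*t M 1≉0 p char G) ,
  (λ G _ → TTColouring.χ<p*t +-0-abelianGroup 0 integerCounter G)
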